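{- Let $t$ be a $\lambda$-term in de Bruijn notation such that $t:\ell$ is derivable in the $\mathcal{L}$-type system described in the context, for some $\mathcal{L}$-type $\ell$. Then $t$ is affine.
   Context: Terms with implicit names (de Bruijn notation) are given by $t ::= \underline{n} \mid \lambda t \mid t\,t$ with $n\in\mathbb{N}$; an occurrence of $\underline{k}$ lying under $d$ abstractions of the term refers to the $(k+1)$-th enclosing abstraction if $k<d$, and otherwise to the free variable number $k-d$. A term is affine if no two distinct occurrences of indices in it refer to the same abstraction or to the same free variable. $\mathcal{L}$-types are finite lists of natural numbers. The partial merge $\ddagger$: $[]\ddagger \ell=\ell$; $(i::\ell)\ddagger []=i::\ell$; $(i_1::\ell_1)\ddagger(i_2::\ell_2)= i_1::(\ell_1\ddagger(i_2::\ell_2))$ if $i_1<i_2$, $=i_2::((i_1::\ell_1)\ddagger \ell_2)$ if $i_1>i_2$, undefined when the recursion reaches equal heads. The partial decrement $\downarrow$ is defined only on lists with all elements strictly positive: $\downarrow[]=[]$, $\downarrow((i+1)::\ell)=i::\downarrow\ell$. Typing rules: (ind) $\underline{i}:[i]$; (abs) if $t:0::\ell$ then $\lambda t:\downarrow\ell$ (when defined); (app) if $t_1:\ell_1$ and $t_2:\ell_2$ then $t_1\,t_2:\ell_1\ddagger\ell_2$ (when defined). -}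

module Defs where

open import Data.Nat using (ℕ; zero; suc; _<_; _>_; _∸_)
open import Data.List using (List; []; _∷_; _++_; length; map)
open import Data.List.Relation.Unary.Unique.Propositional using (Unique)
open import Data.Maybe using (Maybe; just; nothing)

data Term : Set where
  var : ℕ → Term
  lam : Term → Term
  app : Term → Term → Term

data Dir : Set where
  ↓body ↓left ↓right : Dir

Pos : Set
Pos = List Dir

-- What an index occurrence refers to: an enclosing abstraction (identified
-- by its position in the whole term) or a free variable number.
data Ref : Set where
  bound : Pos → Ref
  free  : ℕ → Ref

lookupBinder : List Pos → ℕ → Maybe Pos
lookupBinder []       _       = nothing
lookupBinder (p ∷ ps) zero    = just p
lookupBinder (p ∷ ps) (suc k) = lookupBinder ps k

resolve : List Pos → ℕ → Ref
resolve ps k with lookupBinder ps k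
... | just p  = bound p
... | nothing = free (k ∸ length ps)

-- refsAt here binders t : the references of all index occurrences of the
-- subterm t, located at position 'here' (reversed path), under the enclosing
-- abstractions 'binders' (positions, innermost first).
refsAt : Pos → List Pos → Term → List Ref
refsAt here bs (var k)     = resolve bs k ∷ []
refsAt here bs (lam t)     = refsAt (↓body ∷ here) (here ∷ bs) t
refsAt here bs (app t₁ t₂) = refsAt (↓left ∷ here) bs t₁ ++ refsAt (↓right ∷ here) bs t₂

refs : Term → List Ref
refs = refsAt [] []

-- t is affine: no two distinct occurrences refer to the same abstraction
-- or to the same free variable.
Affine : Term → Set
Affine t = Unique (refs t)

LType : Set
LType = List ℕ

data Merge : LType → LType → LType → Set where
  nil-l : ∀ {ℓ} → Merge [] ℓ ℓ
  nil-r : ∀ {i ℓ} → Merge (i ∷ ℓ) [] (i ∷ ℓ)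
  lt    : ∀ {i₁ i₂ ℓ₁ ℓ₂ ℓ} → i₁ < i₂ → Merge ℓ₁ (i₂ ∷ ℓ₂) ℓ →
          Merge (i₁ ∷ ℓ₁) (i₂ ∷ ℓ₂) (i₁ ∷ ℓ)
  gt    : ∀ {i₁ i₂ ℓ₁ ℓ₂ ℓ} → i₁ > i₂ → Merge (i₁ ∷ ℓ₁) ℓ₂ ℓ →
          Merge (i₁ ∷ ℓ₁) (i₂ ∷ ℓ₂) (i₂ ∷ ℓ)

data Dec↓ : LType → LType → Set where
  nil  : Dec↓ [] []
  cons : ∀ {i ℓ ℓ'} → Dec↓ ℓ ℓ' → Dec↓ (suc i ∷ ℓ) (i ∷ ℓ')

data _∶_ : Term → LType → Set where
  ind : ∀ i → var i ∶ (i ∷ [])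
  abs : ∀ {t ℓ ℓ'} → t ∶ (0 ∷ ℓ) → Dec↓ ℓ ℓ' → lam t ∶ ℓ'
  ap  : ∀ {t₁ t₂ ℓ₁ ℓ₂ ℓ} → t₁ ∶ ℓ₁ → t₂ ∶ ℓ₂ → Merge ℓ₁ ℓ₂ ℓ → app t₁ t₂ ∶ ℓ

{-# OPTIONS --safe #-}
-- A derivation t : ℓ makes ℓ the strictly increasing list of the free indices
-- of t, since ↓ and ‡ preserve strict sortedness. Every occurrence in a subterm
-- therefore refers either to an abstraction inside that subterm or to the
-- enclosing binder (or free variable) named by some index of ℓ, and distinct
-- indices name distinct references. In an application the two sides share no
-- inner abstraction (they sit in different branches) and no index of their
-- types (‡ is undefined on common elements), and the abstraction rule lets
-- only the single index 0 of the body refer to the new binder.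
module Submission where

open import Defs
open import Data.Nat using (ℕ; zero; suc; _<_; _≤_; s<s⁻¹)
open import Data.Nat.Properties using (<-trans; <-irrefl; <-≤-trans; ≤-<-trans; n≤1+n; n<1+n; m≤n+m)
open import Data.List using (List; []; _∷_; _++_; _∷ʳ_; length)
open import Data.List.Properties using (++-assoc; ++-cancelʳ; ∷ʳ-injective; length-++)
open import Data.List.Relation.Unary.All as All using (All; []; _∷_)
open import Data.List.Relation.Unary.AllPairs using (AllPairs; []; _∷_)
open import Data.List.Relation.Unary.Any using (here; there)
open import Data.List.Relation.Unary.Unique.Propositional using (Unique)
import Data.List.Relation.Unary.Unique.Propositional.Properties as Unique
open import Data.List.Relation.Binary.Disjoint.Propositional using (Disjoint)
open import Data.List.Membership.Propositional using (_∈_)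
open import Data.List.Membership.Propositional.Properties using (∈-++⁻)
open import Data.Maybe using (just; nothing)
open import Data.Product using (∃; _×_; _,_; proj₂)
open import Data.Sum as Sum using (_⊎_; inj₁; inj₂)
open import Function using (_∘_)
open import Data.Empty using (⊥; ⊥-elim)
open import Relation.Nullary using (¬_)
open import Relation.Binary.PropositionalEquality using (_≡_; _≢_; refl; sym; trans; cong; subst)

Sorted : LType → Set
Sorted = AllPairs _<_

below-sorted : ∀ {i j ℓ} → i < j → Sorted (j ∷ ℓ) → All (i <_) (j ∷ ℓ)
below-sorted i<j (j<ℓ ∷ _) = i<j ∷ All.map (<-trans i<j) j<ℓ

Dec↓-All : ∀ {i ℓ ℓ'} → Dec↓ ℓ ℓ' → All (suc i <_) ℓ → All (i <_) ℓ'
Dec↓-All nil      []       = []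
Dec↓-All (cons d) (p ∷ ps) = s<s⁻¹ p ∷ Dec↓-All d ps

Dec↓-sorted : ∀ {ℓ ℓ'} → Dec↓ ℓ ℓ' → Sorted ℓ → Sorted ℓ'
Dec↓-sorted nil      []       = []
Dec↓-sorted (cons d) (p ∷ ps) = Dec↓-All d p ∷ Dec↓-sorted d ps

Dec↓-∈ : ∀ {ℓ ℓ' j} → Dec↓ ℓ ℓ' → suc j ∈ ℓ → j ∈ ℓ'
Dec↓-∈ (cons d) (here refl) = here refl
Dec↓-∈ (cons d) (there p)   = there (Dec↓-∈ d p)

Merge-All : ∀ {P : ℕ → Set} {ℓ₁ ℓ₂ ℓ} → Merge ℓ₁ ℓ₂ ℓ → All P ℓ₁ → All P ℓ₂ → All P ℓ
Merge-All nil-l    _        ps₂        = ps₂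
Merge-All nil-r    ps₁      _          = ps₁
Merge-All (lt _ m) (p ∷ ps₁) ps₂       = p ∷ Merge-All m ps₁ ps₂
Merge-All (gt _ m) ps₁      (p ∷ ps₂) = p ∷ Merge-All m ps₁ ps₂

Merge-sorted : ∀ {ℓ₁ ℓ₂ ℓ} → Merge ℓ₁ ℓ₂ ℓ → Sorted ℓ₁ → Sorted ℓ₂ → Sorted ℓ
Merge-sorted nil-l s₁ s₂ = s₂
Merge-sorted nil-r s₁ s₂ = s₁
Merge-sorted (lt i<j m) (p ∷ s₁) s₂ = Merge-All m p (below-sorted i<j s₂) ∷ Merge-sorted m s₁ s₂
Merge-sorted (gt j<i m) s₁ (p ∷ s₂) = Merge-All m (below-sorted j<i s₁) p ∷ Merge-sorted m s₁ s₂

Merge-∈ˡ : ∀ {ℓ₁ ℓ₂ ℓ x} → Merge ℓ₁ ℓ₂ ℓ → x ∈ ℓ₁ → x ∈ ℓ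
Merge-∈ˡ nil-r    p         = p
Merge-∈ˡ (lt _ m) (here e)  = here e
Merge-∈ˡ (lt _ m) (there p) = there (Merge-∈ˡ m p)
Merge-∈ˡ (gt _ m) p         = there (Merge-∈ˡ m p)

Merge-∈ʳ : ∀ {ℓ₁ ℓ₂ ℓ x} → Merge ℓ₁ ℓ₂ ℓ → x ∈ ℓ₂ → x ∈ ℓ
Merge-∈ʳ nil-l    p         = p
Merge-∈ʳ (lt _ m) p         = there (Merge-∈ʳ m p)
Merge-∈ʳ (gt _ m) (here e)  = here e
Merge-∈ʳ (gt _ m) (there p) = there (Merge-∈ʳ m p)

Merge-disjoint : ∀ {ℓ₁ ℓ₂ ℓ} → Merge ℓ₁ ℓ₂ ℓ → Sorted ℓ₁ → Sorted ℓ₂ → Disjoint ℓ₁ ℓ₂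
Merge-disjoint (lt i<j m) _ s₂ (here refl , q) = <-irrefl refl (All.lookup (below-sorted i<j s₂) q)
Merge-disjoint (lt i<j m) (_ ∷ s₁) s₂ (there p , q) = Merge-disjoint m s₁ s₂ (p , q)
Merge-disjoint (gt j<i m) s₁ _ (p , here refl) = <-irrefl refl (All.lookup (below-sorted j<i s₁) p)
Merge-disjoint (gt j<i m) s₁ (_ ∷ s₂) (p , there q) = Merge-disjoint m s₁ s₂ (p , q)

typed-sorted : ∀ {t ℓ} → t ∶ ℓ → Sorted ℓ
typed-sorted (ind i) = [] ∷ []
typed-sorted (abs d dec) with typed-sorted d
... | _ ∷ s = Dec↓-sorted dec s
typed-sorted (ap d₁ d₂ m) = Merge-sorted m (typed-sorted d₁) (typed-sorted d₂)

-- Recording only the depths (lengths) of the enclosing binders of a node at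
-- depth n already makes resolve injective.
data Enclosing : ℕ → List Pos → Set where
  []  : ∀ {n} → Enclosing n []
  _∷_ : ∀ {n p ps} → length p < n → Enclosing (length p) ps → Enclosing n (p ∷ ps)

Enclosing-weaken : ∀ {m n bs} → m ≤ n → Enclosing m bs → Enclosing n bs
Enclosing-weaken m≤n []        = []
Enclosing-weaken m≤n (p<m ∷ e) = <-≤-trans p<m m≤n ∷ e

resolve-suc : ∀ p ps k → resolve (p ∷ ps) (suc k) ≡ resolve ps k
resolve-suc p ps k with lookupBinder ps k
... | just _  = refl
... | nothing = refl

resolve-bound-shallower : ∀ {n bs k q} → Enclosing n bs → resolve bs k ≡ bound q → length q < n
resolve-bound-shallower {k = zero}  (p<n ∷ _) refl = p<n
resolve-bound-shallower {bs = p ∷ ps} {suc k} (p<n ∷ e) eq =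
  <-trans (resolve-bound-shallower e (trans (sym (resolve-suc p ps k)) eq)) p<n

resolve-outer≢head : ∀ {p ps k} → Enclosing (length p) ps → resolve (p ∷ ps) (suc k) ≢ bound p
resolve-outer≢head {p} {ps} {k} e eq =
  <-irrefl refl (resolve-bound-shallower e (trans (sym (resolve-suc p ps k)) eq))

resolve-injective : ∀ {n bs j k} → Enclosing n bs → resolve bs j ≡ resolve bs k → j ≡ k
resolve-injective {bs = []}     _ refl = refl
resolve-injective {bs = p ∷ ps} {zero}  {zero}  _       _  = refl
resolve-injective {bs = p ∷ ps} {zero}  {suc k} (_ ∷ e) eq = ⊥-elim (resolve-outer≢head e (sym eq))
resolve-injective {bs = p ∷ ps} {suc j} {zero}  (_ ∷ e) eq = ⊥-elim (resolve-outer≢head e eq)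
resolve-injective {bs = p ∷ ps} {suc j} {suc k} (_ ∷ e) eq =
  cong suc (resolve-injective e (trans (sym (resolve-suc p ps j)) (trans eq (resolve-suc p ps k))))

bound-injective : ∀ {p q} → bound p ≡ bound q → p ≡ q
bound-injective refl = refl

++-∷-injective : ∀ {A : Set} (q₁ q₂ : List A) {d₁ d₂} h → q₁ ++ d₁ ∷ h ≡ q₂ ++ d₂ ∷ h → d₁ ≡ d₂
++-∷-injective q₁ q₂ {d₁} {d₂} h eq = proj₂ (∷ʳ-injective q₁ q₂ (++-cancelʳ h (q₁ ∷ʳ d₁) (q₂ ∷ʳ d₂) eq′))
  where
  eq′ : (q₁ ∷ʳ d₁) ++ h ≡ (q₂ ∷ʳ d₂) ++ h
  eq′ = trans (++-assoc q₁ _ h) (trans eq (sym (++-assoc q₂ _ h)))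

-- Positions are reversed paths, so q ++ h lies at or below h.
Within : Pos → Ref → Set
Within h r = ∃ λ q → r ≡ bound (q ++ h)

Within-parent : ∀ d {h r} → Within (d ∷ h) r → Within h r
Within-parent d {h} (q , refl) = q ∷ʳ d , cong bound (sym (++-assoc q (d ∷ []) h))

resolve-not-Within : ∀ {h bs k} → Enclosing (length h) bs → ¬ Within h (resolve bs k)
resolve-not-Within {h} e (q , eq) = <-irrefl refl (≤-<-trans h≤q++h (resolve-bound-shallower e eq))
  where
  h≤q++h : length h ≤ length (q ++ h)
  h≤q++h = subst (length h ≤_) (sym (length-++ q)) (m≤n+m (length h) (length q))

Resolves : List Pos → LType → Ref → Set
Resolves bs ℓ r = ∃ λ k → k ∈ ℓ × r ≡ resolve bs k

Resolves-mono : ∀ {bs ℓ₁ ℓ₂ r} → (∀ {k} → k ∈ ℓ₁ → k ∈ ℓ₂) → Resolves bs ℓ₁ r → Resolves bs ℓ₂ r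
Resolves-mono ⊆ (k , k∈ℓ₁ , eq) = k , ⊆ k∈ℓ₁ , eq

Resolves-pop : ∀ {h bs ℓ ℓ' r} → Dec↓ ℓ ℓ' → Resolves (h ∷ bs) (0 ∷ ℓ) r → Within h r ⊎ Resolves bs ℓ' r
Resolves-pop          dec (zero  , _           , eq) = inj₁ ([] , eq)
Resolves-pop {h} {bs} dec (suc k , there k+1∈ℓ , eq) = inj₂ (k , Dec↓-∈ dec k+1∈ℓ , trans eq (resolve-suc h bs k))

refsAt-origin : ∀ {t ℓ h bs r} → t ∶ ℓ → r ∈ refsAt h bs t → Within h r ⊎ Resolves bs ℓ r
refsAt-origin (ind i) (here eq) = inj₂ (i , here refl , eq)
refsAt-origin (abs d dec) p = Sum.[ inj₁ ∘ Within-parent ↓body , Resolves-pop dec ] (refsAt-origin d p)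
refsAt-origin {h = h} {bs} (ap {t₁} d₁ d₂ m) p with ∈-++⁻ (refsAt (↓left ∷ h) bs t₁) p
... | inj₁ p₁ = Sum.map (Within-parent ↓left) (Resolves-mono (Merge-∈ˡ m)) (refsAt-origin d₁ p₁)
... | inj₂ p₂ = Sum.map (Within-parent ↓right) (Resolves-mono (Merge-∈ʳ m)) (refsAt-origin d₂ p₂)

sibling-origins-disjoint : ∀ {h bs ℓ₁ ℓ₂ r} → Enclosing (length h) bs → Disjoint ℓ₁ ℓ₂ →
  Within (↓left ∷ h) r ⊎ Resolves bs ℓ₁ r → Within (↓right ∷ h) r ⊎ Resolves bs ℓ₂ r → ⊥
sibling-origins-disjoint {h} _ _ (inj₁ (q₁ , eq₁)) (inj₁ (q₂ , eq₂))
  with () ← ++-∷-injective q₁ q₂ h (bound-injective (trans (sym eq₁) eq₂))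
sibling-origins-disjoint e _ (inj₁ w) (inj₂ (_ , _ , refl)) = resolve-not-Within e (Within-parent ↓left w)
sibling-origins-disjoint e _ (inj₂ (_ , _ , refl)) (inj₁ w) = resolve-not-Within e (Within-parent ↓right w)
sibling-origins-disjoint e ℓ₁#ℓ₂ (inj₂ (_ , k₁∈ℓ₁ , refl)) (inj₂ (_ , k₂∈ℓ₂ , eq))
  with refl ← resolve-injective e eq = ℓ₁#ℓ₂ (k₁∈ℓ₁ , k₂∈ℓ₂)

refsAt-unique : ∀ {t ℓ h bs} → t ∶ ℓ → Enclosing (length h) bs → Unique (refsAt h bs t)
refsAt-unique (ind _)     _ = [] ∷ []
refsAt-unique (abs d _)   e = refsAt-unique d (n<1+n _ ∷ e)
refsAt-unique {h = h} {bs} (ap d₁ d₂ m) e =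
  Unique.++⁺ (refsAt-unique d₁ e′) (refsAt-unique d₂ e′) λ (p₁ , p₂) →
    sibling-origins-disjoint e (Merge-disjoint m (typed-sorted d₁) (typed-sorted d₂))
      (refsAt-origin d₁ p₁) (refsAt-origin d₂ p₂)
  where
  e′ : Enclosing (suc (length h)) bs
  e′ = Enclosing-weaken (n≤1+n _) e

proposition2 : ∀ (t : Term) (ℓ : LType) → t ∶ ℓ → Affine t
proposition2 t ℓ d = refsAt-unique d []
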